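{- Let $p$ be a prime, $K$ a field of characteristic $p$, $n\geq2$ an integer, $r=n-1$, and $f\in K^\times$. Let $A=K[t]/(t^{p^n})$ with the Hopf algebra structure given by \[ \Delta(t)=t\otimes1+1\otimes t+f\sum_{\ell=1}^{p-1}\frac{1}{\ell!(p-\ell)!}t^{p^{r}\ell}\otimes t^{p^{r}(p-\ell)},\quad \varepsilon(t)=0,\quad \lambda(t)=-t, \] and let $H=\operatorname{Hom}_K(A,K)$ be its linear dual algebra, with multiplication $(\phi\psi)(h)=\operatorname{mult}(\phi\otimes\psi)\Delta(h)$. For $0\le j\le p^n-1$ let $z_j\in H$ be defined by $z_j(t^i)=\delta_{i,j}$. Then for $0\leq s\leq r-1$, $z_{p^{s}}^{p}=0$.
   Context: $\delta_{i,j}$ is the Kronecker delta. The coefficients $1/(\ell!(p-\ell)!)$, $1\le\ell\le p-1$, are interpreted in $\mathbb{F}_p\subseteq K$. -}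

module Defs where

open import Level using (_⊔_)
open import Algebra.Bundles using (CommutativeRing)
open import Data.Nat as ℕ using (ℕ; zero; suc; _∸_; _^_; _≡ᵇ_)
open import Data.Nat.Base using (_!)
open import Data.Bool using (if_then_else_; _∧_)
open import Relation.Nullary using (¬_)

record Field (c ℓ : Level.Level) : Set (Level.suc (c ⊔ ℓ)) where
  field
    commutativeRing : CommutativeRing c ℓ
  open CommutativeRing commutativeRing public
  field
    _⁻¹      : Carrier → Carrier
    ⁻¹-inverse : ∀ x → ¬ (x ≈ 0#) → x * (x ⁻¹) ≈ 1#
    1≉0      : ¬ (1# ≈ 0#)

module Construction {c ℓ} (F : Field c ℓ) where
  open Field F

  ι : ℕ → Carrier
  ι zero    = 0#
  ι (suc m) = 1# + ι m

  Σ< : ℕ → (ℕ → Carrier) → Carrier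
  Σ< zero    g = 0#
  Σ< (suc m) g = Σ< m g + g m

  Σ[_⋯_] : ℕ → ℕ → (ℕ → Carrier) → Carrier
  Σ[ lo ⋯ hi ] g = Σ< (suc hi ∸ lo) (λ k → g (lo ℕ.+ k))

  -- Elements of K[x] ⊗ K[x] ≅ K[x,y]: coefficient of t^a ⊗ t^b.
  -- A ⊗ A = (K[t]/(t^N)) ⊗ (K[t]/(t^N)) is the quotient by t^N⊗1, 1⊗t^N;
  -- its coefficients are those at (a , b) with a , b < N, which depend only
  -- on coefficients with indices < N, so we compute in K[x,y] and read off
  -- only indices below N.
  Tensor : Set c
  Tensor = ℕ → ℕ → Carrier

  _⊕_ : Tensor → Tensor → Tensor
  (u ⊕ v) a b = u a b + v a b

  -- product in K[t] ⊗ K[t]: (t^a ⊗ t^b)(t^c ⊗ t^d) = t^(a+c) ⊗ t^(b+d)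
  _⊗·_ : Tensor → Tensor → Tensor
  (u ⊗· v) a b = Σ< (suc a) λ a₁ → Σ< (suc b) λ b₁ → u a₁ b₁ * v (a ∸ a₁) (b ∸ b₁)

  mono : ℕ → ℕ → Carrier → Tensor
  mono a b k i j = if (i ≡ᵇ a) ∧ (j ≡ᵇ b) then k else 0#

  Σ⊗[_⋯_] : ℕ → ℕ → (ℕ → Tensor) → Tensor
  Σ⊗[ lo ⋯ hi ] g a b = Σ[ lo ⋯ hi ] (λ ℓ′ → g ℓ′ a b)

  _⊗^_ : Tensor → ℕ → Tensor
  u ⊗^ zero  = mono 0 0 1#
  u ⊗^ suc m = u ⊗· (u ⊗^ m)

  module Hopf (p n : ℕ) (f : Carrier) where
    N : ℕ
    N = p ^ n

    r : ℕ
    r = n ∸ 1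

    coeff : ℕ → Carrier
    coeff ℓ′ = (ι ((ℓ′ !) ℕ.* ((p ∸ ℓ′) !))) ⁻¹

    Δt : Tensor
    Δt = (mono 1 0 1# ⊕ mono 0 1 1#)
         ⊕ Σ⊗[ 1 ⋯ p ∸ 1 ] (λ ℓ′ → mono (p ^ r ℕ.* ℓ′) (p ^ r ℕ.* (p ∸ ℓ′)) (f * coeff ℓ′))

    -- Δ is an algebra map: Δ(t^i) = Δ(t)^i
    Δ : ℕ → Tensor
    Δ i = Δt ⊗^ i

    -- H = Hom_K(A, K): a functional is determined by its values on the basis
    -- t^i, 0 ≤ i < N (values at i ≥ N are irrelevant and never used).
    Dual : Set c
    Dual = ℕ → Carrier

    _⋆_ : Dual → Dual → Dual
    (φ ⋆ ψ) i = Σ< N λ a → Σ< N λ b → Δ i a b * (φ a * ψ b)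

    -- unit of H is the counit ε: ε(t^i) = δ_{i,0}
    εH : Dual
    εH i = if i ≡ᵇ 0 then 1# else 0#

    _^H_ : Dual → ℕ → Dual
    φ ^H zero  = εH
    φ ^H suc m = φ ⋆ (φ ^H m)

    z : ℕ → Dual
    z j i = if i ≡ᵇ j then 1# else 0#

{-# OPTIONS --safe #-}
-- Below t-degree p^r the extra term of Δ(t) is invisible, so there Δ(t^i) has the
-- coefficients of (t⊗1 + 1⊗t)^i.  For j < p^r this gives (z_j ψ)(t^i) = C(i,j) ψ(t^(i-j)),
-- hence z_j^k is supported on t^(kj) with value ∏_{m ≤ k} C(mj, j) = (kj)!/(j!)^k.
-- For j = p^s with s < r and k = p this contains the factor C(pj, j) = p C(pj-1, j-1),
-- which vanishes in characteristic p.
module Submission where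

open import Defs
open import Data.Nat using (ℕ; _<_; _≤_; _^_)
open import Data.Nat.Primality using (Prime; prime⇒nonZero; prime⇒nonTrivial)
open import Relation.Nullary using (¬_)

import Data.Nat.Base as Nat
open import Data.Nat.Base using (zero; suc; _∸_; _≡ᵇ_; z≤n; s≤s; NonZero; nonTrivial⇒n>1)
import Data.Nat.Properties as ℕₚ
open import Data.Nat.Combinatorics using (_C_; nCk+nC[k+1]≡[n+1]C[k+1]; nCn≡1; nC1≡n)
open import Data.Nat.Divisibility using (_∣_; divides; ∣m⇒∣m*n)
open import Data.Bool.Base using (true; false; T; if_then_else_)
open import Data.Product.Base using (_×_; _,_)
open import Data.Sum.Base using (_⊎_; inj₁; inj₂; [_,_])
open import Data.Empty using (⊥-elim)
import Relation.Binary.PropositionalEquality as ≡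
open ≡ using (_≡_; _≢_)
open import Relation.Nullary using (yes; no)
open import Algebra.Properties.CommutativeSemigroup using (interchange)
import Relation.Binary.Reasoning.Setoid as ≈-Reasoning

module _ where
  open Nat using (_+_; _*_)
  open ℕₚ
  open ≡ using (refl; cong; cong₂; subst; module ≡-Reasoning) renaming (sym to ≡-sym; trans to ≡-trans)

  ≡ᵇ-true⇒≡ : ∀ {m n} → (m ≡ᵇ n) ≡ true → m ≡ n
  ≡ᵇ-true⇒≡ {m} {n} eq = ≡ᵇ⇒≡ m n (subst T (≡-sym eq) _)

  module _ {a} {A : Set a} {m n : ℕ} {x y : A} where

    if-≡ᵇ-≡ : m ≡ n → (if m ≡ᵇ n then x else y) ≡ x
    if-≡ᵇ-≡ m≡n with m ≡ᵇ n | ≡⇒≡ᵇ m n m≡n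
    ... | true | _ = refl

    if-≡ᵇ-≢ : m ≢ n → (if m ≡ᵇ n then x else y) ≡ y
    if-≡ᵇ-≢ m≢n with m ≡ᵇ n in eq
    ... | false = refl
    ... | true  = ⊥-elim (m≢n (≡ᵇ-true⇒≡ eq))

  [1+k]*[1+n]C[1+k]≡[1+n]*nCk : ∀ n k → suc k * (suc n C suc k) ≡ suc n * (n C k)
  [1+k]*[1+n]C[1+k]≡[1+n]*nCk zero    zero    = refl
  [1+k]*[1+n]C[1+k]≡[1+n]*nCk zero    (suc k) = *-zeroʳ (suc (suc k))
  [1+k]*[1+n]C[1+k]≡[1+n]*nCk (suc n) zero    =
    ≡-trans (*-identityˡ _) (≡-trans (nC1≡n (suc (suc n))) (≡-sym (*-identityʳ _)))
  [1+k]*[1+n]C[1+k]≡[1+n]*nCk (suc n) (suc k) = begin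
    suc (suc k) * (suc (suc n) C suc (suc k))
      ≡⟨ cong (suc (suc k) *_) (nCk+nC[k+1]≡[n+1]C[k+1] (suc n) (suc k)) ⟨
    suc (suc k) * (A + B)
      ≡⟨ *-distribˡ-+ (suc (suc k)) A B ⟩
    (A + suc k * A) + suc (suc k) * B
      ≡⟨ cong₂ _+_ (cong (A +_) ([1+k]*[1+n]C[1+k]≡[1+n]*nCk n k))
                   ([1+k]*[1+n]C[1+k]≡[1+n]*nCk n (suc k)) ⟩
    (A + suc n * (n C k)) + suc n * (n C suc k)
      ≡⟨ +-assoc A _ _ ⟩
    A + (suc n * (n C k) + suc n * (n C suc k))
      ≡⟨ cong (A +_) (*-distribˡ-+ (suc n) (n C k) (n C suc k)) ⟨
    A + suc n * (n C k + n C suc k)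
      ≡⟨ cong (λ x → A + suc n * x) (nCk+nC[k+1]≡[n+1]C[k+1] n k) ⟩
    suc (suc n) * A
      ∎
    where
    open ≡-Reasoning
    A B : ℕ
    A = suc n C suc k
    B = suc n C suc (suc k)

  -- Absorption gives m · (pm choose m) = pm · (pm - 1 choose m - 1); cancel m.
  p∣[p*m]Cm : ∀ p m .{{_ : NonZero m}} → p ∣ (p * m) C m
  p∣[p*m]Cm zero    (suc m) = divides 0 refl
  p∣[p*m]Cm (suc p) (suc m) = divides X (*-cancelˡ-≡ _ _ (suc m) (begin
    suc m * ((suc p * suc m) C suc m) ≡⟨ [1+k]*[1+n]C[1+k]≡[1+n]*nCk (m + p * suc m) m ⟩
    suc p * suc m * X                ≡⟨ cong (_* X) (*-comm (suc p) (suc m)) ⟩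
    suc m * suc p * X                ≡⟨ *-assoc (suc m) (suc p) X ⟩
    suc m * (suc p * X)              ≡⟨ cong (suc m *_) (*-comm (suc p) X) ⟩
    suc m * (X * suc p)              ∎))
    where
    open ≡-Reasoning
    X : ℕ
    X = (m + p * suc m) C m

  -- = (k j)! / (j!)^k
  multinomial : ℕ → ℕ → ℕ
  multinomial j zero    = 1
  multinomial j (suc k) = ((suc k * j) C j) * multinomial j k

  p∣multinomial : ∀ p j .{{_ : NonZero p}} .{{_ : NonZero j}} → p ∣ multinomial j p
  p∣multinomial (suc p) j = ∣m⇒∣m*n (multinomial j p) (p∣[p*m]Cm (suc p) j)

module _ {c ℓ} (K : Field c ℓ) where
  open Field K
  open Construction K

  ι-+ : ∀ m n → ι (m Nat.+ n) ≈ ι m + ι n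
  ι-+ zero    n = sym (+-identityˡ (ι n))
  ι-+ (suc m) n = trans (+-congˡ (ι-+ m n)) (sym (+-assoc 1# (ι m) (ι n)))

  ι-* : ∀ m n → ι (m Nat.* n) ≈ ι m * ι n
  ι-* zero    n = sym (zeroˡ (ι n))
  ι-* (suc m) n = begin
    ι (n Nat.+ m Nat.* n)    ≈⟨ ι-+ n (m Nat.* n) ⟩
    ι n + ι (m Nat.* n)      ≈⟨ +-cong (sym (*-identityˡ (ι n))) (ι-* m n) ⟩
    1# * ι n + ι m * ι n     ≈⟨ distribʳ (ι n) 1# (ι m) ⟨
    (1# + ι m) * ι n         ∎
    where open ≈-Reasoning setoid

  ι-∣ : ∀ {p m} → ι p ≈ 0# → p ∣ m → ι m ≈ 0#
  ι-∣ {p} ιp≈0 (divides q ≡.refl) = trans (ι-* q p) (trans (*-congˡ ιp≈0) (zeroʳ (ι q)))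

  Σ<-cong : ∀ m {g h : ℕ → Carrier} → (∀ k → k < m → g k ≈ h k) → Σ< m g ≈ Σ< m h
  Σ<-cong zero    g≈h = refl
  Σ<-cong (suc m) g≈h = +-cong (Σ<-cong m (λ k k<m → g≈h k (ℕₚ.m<n⇒m<1+n k<m))) (g≈h m (ℕₚ.n<1+n m))

  Σ<-zero : ∀ m {g : ℕ → Carrier} → (∀ k → k < m → g k ≈ 0#) → Σ< m g ≈ 0#
  Σ<-zero zero    g≈0 = refl
  Σ<-zero (suc m) g≈0 =
    trans (+-cong (Σ<-zero m (λ k k<m → g≈0 k (ℕₚ.m<n⇒m<1+n k<m))) (g≈0 m (ℕₚ.n<1+n m))) (+-identityʳ 0#)

  Σ<-+ : ∀ m (g h : ℕ → Carrier) → Σ< m (λ k → g k + h k) ≈ Σ< m g + Σ< m h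
  Σ<-+ zero    g h = sym (+-identityʳ 0#)
  Σ<-+ (suc m) g h = trans (+-congʳ (Σ<-+ m g h)) (interchange +-commutativeSemigroup _ _ _ _)

  Σ<-single : ∀ m c {g : ℕ → Carrier} → c < m → (∀ k → k < m → k ≢ c → g k ≈ 0#) → Σ< m g ≈ g c
  Σ<-single (suc m) c {g} c<1+m g≈0 with m ℕₚ.≟ c
  ... | yes ≡.refl =
    trans (+-congʳ (Σ<-zero m (λ k k<m → g≈0 k (ℕₚ.m<n⇒m<1+n k<m) (ℕₚ.<⇒≢ k<m)))) (+-identityˡ (g c))
  ... | no m≢c =
    trans (+-cong (Σ<-single m c c<m (λ k k<m → g≈0 k (ℕₚ.m<n⇒m<1+n k<m))) (g≈0 m (ℕₚ.n<1+n m) m≢c))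
          (+-identityʳ (g c))
    where
    c<m : c < m
    c<m = ℕₚ.≤∧≢⇒< (ℕₚ.≤-pred c<1+m) (λ c≡m → m≢c (≡.sym c≡m))

  mono-off : ∀ a b k i j → ¬ (i ≡ a × j ≡ b) → mono a b k i j ≡ 0#
  mono-off a b k i j ≢ab with i ≡ᵇ a in eqa | j ≡ᵇ b in eqb
  ... | false | _     = ≡.refl
  ... | true  | false = ≡.refl
  ... | true  | true  = ⊥-elim (≢ab (≡ᵇ-true⇒≡ eqa , ≡ᵇ-true⇒≡ eqb))

  mono-on : ∀ a b k → mono a b k a b ≡ k
  mono-on a b k with a ≡ᵇ a | ℕₚ.≡⇒≡ᵇ a a ≡.refl | b ≡ᵇ b | ℕₚ.≡⇒≡ᵇ b b ≡.refl
  ... | true | _ | true | _ = ≡.refl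

  mono-off-* : ∀ a b k i j x → ¬ (i ≡ a × j ≡ b) → mono a b k i j * x ≈ 0#
  mono-off-* a b k i j x ≢ab = trans (*-congʳ (reflexive (mono-off a b k i j ≢ab))) (zeroˡ x)

  mono-⊗·-shift : ∀ a₀ b₀ k G a b → (mono a₀ b₀ k ⊗· G) (a₀ Nat.+ a) (b₀ Nat.+ b) ≈ k * G a b
  mono-⊗·-shift a₀ b₀ k G a b = begin
    (mono a₀ b₀ k ⊗· G) (a₀ Nat.+ a) (b₀ Nat.+ b)
      ≈⟨ Σ<-single (suc (a₀ Nat.+ a)) a₀ (s≤s (ℕₚ.m≤m+n a₀ a)) (λ a₁ _ a₁≢a₀ →
           Σ<-zero (suc (b₀ Nat.+ b)) (λ b₁ _ → mono-off-* a₀ b₀ k a₁ b₁ _ (λ (e , _) → a₁≢a₀ e))) ⟩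
    Σ< (suc (b₀ Nat.+ b)) (λ b₁ → mono a₀ b₀ k a₀ b₁ * G (a₀ Nat.+ a ∸ a₀) (b₀ Nat.+ b ∸ b₁))
      ≈⟨ Σ<-single (suc (b₀ Nat.+ b)) b₀ (s≤s (ℕₚ.m≤m+n b₀ b)) (λ b₁ _ b₁≢b₀ →
           mono-off-* a₀ b₀ k a₀ b₁ _ (λ (_ , e) → b₁≢b₀ e)) ⟩
    mono a₀ b₀ k a₀ b₀ * G (a₀ Nat.+ a ∸ a₀) (b₀ Nat.+ b ∸ b₀)
      ≡⟨ ≡.cong₂ _*_ (mono-on a₀ b₀ k) (≡.cong₂ G (ℕₚ.m+n∸m≡n a₀ a) (ℕₚ.m+n∸m≡n b₀ b)) ⟩
    k * G a b
      ∎
    where open ≈-Reasoning setoid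

  mono-⊗·-below : ∀ a₀ b₀ k G a b → a < a₀ ⊎ b < b₀ → (mono a₀ b₀ k ⊗· G) a b ≈ 0#
  mono-⊗·-below a₀ b₀ k G a b below =
    Σ<-zero (suc a) λ a₁ a₁<1+a → Σ<-zero (suc b) λ b₁ b₁<1+b →
      mono-off-* a₀ b₀ k a₁ b₁ _ λ (a₁≡a₀ , b₁≡b₀) →
      [ (λ a<a₀ → ℕₚ.<-irrefl a₁≡a₀ (ℕₚ.≤-<-trans (ℕₚ.m<1+n⇒m≤n a₁<1+a) a<a₀))
      , (λ b<b₀ → ℕₚ.<-irrefl b₁≡b₀ (ℕₚ.≤-<-trans (ℕₚ.m<1+n⇒m≤n b₁<1+b) b<b₀)) ] below

  t⊗1 1⊗t : Tensor
  t⊗1 = mono 1 0 1#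
  1⊗t = mono 0 1 1#

  ⊗·-distribʳ-⊕ : ∀ u v w a b → ((u ⊕ v) ⊗· w) a b ≈ ((u ⊗· w) ⊕ (v ⊗· w)) a b
  ⊗·-distribʳ-⊕ u v w a b =
    trans (Σ<-cong (suc a) (λ a₁ _ → trans (Σ<-cong (suc b) (λ b₁ _ → distribʳ _ _ _)) (Σ<-+ (suc b) _ _)))
          (Σ<-+ (suc a) _ _)

  if-≡ᵇ-cong : ∀ m n {x x′ y} → (m ≡ n → x ≈ x′) →
               (if m ≡ᵇ n then x else y) ≈ (if m ≡ᵇ n then x′ else y)
  if-≡ᵇ-cong m n x≈x′ with m ≡ᵇ n in eq
  ... | true  = x≈x′ (≡ᵇ-true⇒≡ eq)
  ... | false = refl

  if-+ : ∀ c {x y} → (if c then x else 0#) + (if c then y else 0#) ≈ (if c then x + y else 0#)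
  if-+ true  = refl
  if-+ false = +-identityʳ 0#

  binomialTensor : ℕ → Tensor
  binomialTensor i a b = if a Nat.+ b ≡ᵇ i then ι (i C a) else 0#

  binomialTensor-suc : ∀ i a b → ((t⊗1 ⊕ 1⊗t) ⊗· binomialTensor i) a b ≈ binomialTensor (suc i) a b
  binomialTensor-suc i a b = trans (⊗·-distribʳ-⊕ t⊗1 1⊗t (binomialTensor i) a b) (pascal a b)
    where
    B : Tensor
    B = binomialTensor i
    t⊗1-shift : ∀ a b → (t⊗1 ⊗· B) (suc a) b ≈ B a b
    t⊗1-shift a b = trans (mono-⊗·-shift 1 0 1# B a b) (*-identityˡ _)
    1⊗t-shift : ∀ a b → (1⊗t ⊗· B) a (suc b) ≈ B a b
    1⊗t-shift a b = trans (mono-⊗·-shift 0 1 1# B a b) (*-identityˡ _)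
    pascal : ∀ a b → (t⊗1 ⊗· B) a b + (1⊗t ⊗· B) a b ≈ binomialTensor (suc i) a b
    pascal zero zero =
      trans (+-cong (mono-⊗·-below 1 0 1# B 0 0 (inj₁ (s≤s z≤n))) (mono-⊗·-below 0 1 1# B 0 0 (inj₂ (s≤s z≤n))))
            (+-identityˡ 0#)
    pascal zero (suc b) =
      trans (+-cong (mono-⊗·-below 1 0 1# B 0 (suc b) (inj₁ (s≤s z≤n))) (1⊗t-shift 0 b)) (+-identityˡ _)
    pascal (suc a) zero =
      trans (+-cong (t⊗1-shift a 0) (mono-⊗·-below 0 1 1# B (suc a) 0 (inj₂ (s≤s z≤n))))
        (trans (+-identityʳ _) (if-≡ᵇ-cong (a Nat.+ 0) i λ a+0≡i →
          reflexive (≡.cong ι (iCa≡[1+i]C[1+a] (≡.trans (≡.sym (ℕₚ.+-identityʳ a)) a+0≡i)))))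
      where
      iCa≡[1+i]C[1+a] : a ≡ i → i C a ≡ suc i C suc a
      iCa≡[1+i]C[1+a] ≡.refl = ≡.trans (nCn≡1 a) (≡.sym (nCn≡1 (suc a)))
    pascal (suc a) (suc b) = begin
      (t⊗1 ⊗· B) (suc a) (suc b) + (1⊗t ⊗· B) (suc a) (suc b)
        ≈⟨ +-cong (t⊗1-shift a (suc b)) (1⊗t-shift (suc a) b) ⟩
      B a (suc b) + B (suc a) b
        ≡⟨ ≡.cong (λ c → B a (suc b) + (if c ≡ᵇ i then ι (i C suc a) else 0#)) (ℕₚ.+-suc a b) ⟨
      (if a Nat.+ suc b ≡ᵇ i then ι (i C a) else 0#) + (if a Nat.+ suc b ≡ᵇ i then ι (i C suc a) else 0#)
        ≈⟨ if-+ (a Nat.+ suc b ≡ᵇ i) ⟩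
      (if a Nat.+ suc b ≡ᵇ i then ι (i C a) + ι (i C suc a) else 0#)
        ≈⟨ if-≡ᵇ-cong (a Nat.+ suc b) i (λ _ → trans (sym (ι-+ (i C a) (i C suc a))) (reflexive (≡.cong ι (nCk+nC[k+1]≡[n+1]C[k+1] i a)))) ⟩
      binomialTensor (suc i) (suc a) (suc b)
        ∎
      where open ≈-Reasoning setoid

  binomialTensor-off : ∀ i a b → a Nat.+ b ≢ i → binomialTensor i a b ≈ 0#
  binomialTensor-off i a b a+b≢i = reflexive (if-≡ᵇ-≢ {m = a Nat.+ b} {n = i} a+b≢i)

  _≈[<_]_ : Tensor → ℕ → Tensor → Set ℓ
  u ≈[< M ] v = ∀ a b → a < M → u a b ≈ v a b

  ⊗·-cong-below : ∀ {M u u′ v v′} → u ≈[< M ] u′ → v ≈[< M ] v′ → (u ⊗· v) ≈[< M ] (u′ ⊗· v′)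
  ⊗·-cong-below u≈u′ v≈v′ a b a<M =
    Σ<-cong (suc a) λ a₁ a₁<1+a → Σ<-cong (suc b) λ b₁ _ →
      *-cong (u≈u′ a₁ b₁ (ℕₚ.≤-<-trans (ℕₚ.m<1+n⇒m≤n a₁<1+a) a<M))
             (v≈v′ (a ∸ a₁) (b ∸ b₁) (ℕₚ.≤-<-trans (ℕₚ.m∸n≤m a a₁) a<M))

  module _ (p n : ℕ) (f : Carrier) .{{_ : NonZero p}} where
    open Hopf p n f

    Δt-below : Δt ≈[< p ^ r ] (t⊗1 ⊕ 1⊗t)
    Δt-below a b a<pʳ = trans (+-congˡ (Σ<-zero (suc (p ∸ 1) ∸ 1) λ ℓ′ _ →
        reflexive (mono-off _ _ _ a b λ (a≡pʳ[1+ℓ′] , _) →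
          ℕₚ.<-irrefl a≡pʳ[1+ℓ′] (ℕₚ.<-≤-trans a<pʳ (ℕₚ.m≤m*n (p ^ r) (suc ℓ′))))))
      (+-identityʳ _)

    Δ-below : ∀ i → Δ i ≈[< p ^ r ] binomialTensor i
    Δ-below zero    zero    zero    _    = sym (+-identityʳ 1#)
    Δ-below zero    zero    (suc b) _    = refl
    Δ-below zero    (suc a) b       _    = refl
    Δ-below (suc i) a       b       a<pʳ =
      trans (⊗·-cong-below {u = Δt} {v = Δ i} Δt-below (Δ-below i) a b a<pʳ) (binomialTensor-suc i a b)

    pʳ≤N : p ^ r ≤ N
    pʳ≤N = ℕₚ.^-monoʳ-≤ p (ℕₚ.m∸n≤m n 1)

    z⋆-binomial : ∀ {j} ψ i → j < p ^ r → (z j ⋆ ψ) i ≈ Σ< N (λ b → binomialTensor i j b * ψ b)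
    z⋆-binomial {j} ψ i j<pʳ =
      trans (Σ<-single N j (ℕₚ.<-≤-trans j<pʳ pʳ≤N) λ a _ a≢j → Σ<-zero N λ b _ →
               trans (*-congˡ (trans (*-congʳ (reflexive (if-≡ᵇ-≢ {m = a} {n = j} a≢j))) (zeroˡ (ψ b))))
                     (zeroʳ _))
            (Σ<-cong N λ b _ →
               *-cong (Δ-below i j b j<pʳ)
                      (trans (*-congʳ (reflexive (if-≡ᵇ-≡ {m = j} {n = j} ≡.refl))) (*-identityˡ (ψ b))))

    z⋆-≥ : ∀ {j i} ψ → j < p ^ r → j ≤ i → i < N → (z j ⋆ ψ) i ≈ ι (i C j) * ψ (i ∸ j)
    z⋆-≥ {j} {i} ψ j<pʳ j≤i i<N =
      trans (z⋆-binomial ψ i j<pʳ)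
        (trans (Σ<-single N (i ∸ j) (ℕₚ.≤-<-trans (ℕₚ.m∸n≤m i j) i<N) λ b _ b≢i∸j →
                  trans (*-congʳ (binomialTensor-off i j b λ j+b≡i →
                           b≢i∸j (≡.trans (≡.sym (ℕₚ.m+n∸m≡n j b)) (≡.cong (_∸ j) j+b≡i))))
                        (zeroˡ _))
               (*-congʳ (reflexive (if-≡ᵇ-≡ {m = j Nat.+ (i ∸ j)} {n = i} (ℕₚ.m+[n∸m]≡n j≤i)))))

    z⋆-< : ∀ {j i} ψ → j < p ^ r → i < j → (z j ⋆ ψ) i ≈ 0#
    z⋆-< {j} {i} ψ j<pʳ i<j =
      trans (z⋆-binomial ψ i j<pʳ)
        (Σ<-zero N λ b _ →
           trans (*-congʳ (binomialTensor-off i j b λ j+b≡i →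
                    ℕₚ.<⇒≱ i<j (≡.subst (j ≤_) j+b≡i (ℕₚ.m≤m+n j b))))
                 (zeroˡ _))

    z^H-off : ∀ {j} → j < p ^ r → ∀ k i → i < N → i ≢ k Nat.* j → (z j ^H k) i ≈ 0#
    z^H-off j<pʳ zero i _ i≢0 = reflexive (if-≡ᵇ-≢ {m = i} {n = 0} i≢0)
    z^H-off {j} j<pʳ (suc k) i i<N i≢[1+k]j with j ℕₚ.≤? i
    ... | no  j≰i = z⋆-< _ j<pʳ (ℕₚ.≰⇒> j≰i)
    ... | yes j≤i =
      trans (z⋆-≥ _ j<pʳ j≤i i<N)
        (trans (*-congˡ (z^H-off j<pʳ k (i ∸ j) (ℕₚ.≤-<-trans (ℕₚ.m∸n≤m i j) i<N) i∸j≢kj)) (zeroʳ _))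
      where
      i∸j≢kj : i ∸ j ≢ k Nat.* j
      i∸j≢kj i∸j≡kj = i≢[1+k]j (≡.trans (≡.sym (ℕₚ.m+[n∸m]≡n j≤i)) (≡.cong (j Nat.+_) i∸j≡kj))

    z^H-on : ∀ {j} → j < p ^ r → ∀ k → k Nat.* j < N → (z j ^H k) (k Nat.* j) ≈ ι (multinomial j k)
    z^H-on j<pʳ zero _ = sym (+-identityʳ 1#)
    z^H-on {j} j<pʳ (suc k) [1+k]j<N = begin
      (z j ^H suc k) (j Nat.+ k Nat.* j)
        ≈⟨ z⋆-≥ _ j<pʳ (ℕₚ.m≤m+n j (k Nat.* j)) [1+k]j<N ⟩
      ι binom * (z j ^H k) (j Nat.+ k Nat.* j ∸ j)
        ≡⟨ ≡.cong (λ x → ι binom * (z j ^H k) x) (ℕₚ.m+n∸m≡n j (k Nat.* j)) ⟩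
      ι binom * (z j ^H k) (k Nat.* j)
        ≈⟨ *-congˡ (z^H-on j<pʳ k (ℕₚ.≤-<-trans (ℕₚ.m≤n+m (k Nat.* j) j) [1+k]j<N)) ⟩
      ι binom * ι (multinomial j k)
        ≈⟨ ι-* binom (multinomial j k) ⟨
      ι (multinomial j (suc k))
        ∎
      where
      open ≈-Reasoning setoid
      binom : ℕ
      binom = (suc k Nat.* j) C j

    z^H-vanishes : ∀ {j} k → j < p ^ r → ι (multinomial j k) ≈ 0# → ∀ i → i < N → (z j ^H k) i ≈ 0#
    z^H-vanishes {j} k j<pʳ ι[multinomial]≈0 i i<N with i ℕₚ.≟ k Nat.* j
    ... | yes ≡.refl = trans (z^H-on j<pʳ k i<N) ι[multinomial]≈0
    ... | no  i≢kj   = z^H-off j<pʳ k i i<N i≢kj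

lemma5p3 : ∀ {c ℓ} (K : Field c ℓ) (p : ℕ) → Prime p
    → Field._≈_ K (Construction.ι K p) (Field.0# K)
    → (n : ℕ) → 2 ≤ n
    → (f : Field.Carrier K) → ¬ (Field._≈_ K f (Field.0# K))
    → (s : ℕ) → s < Construction.Hopf.r K p n f
    → (i : ℕ) → i < Construction.Hopf.N K p n f
    → Field._≈_ K (Construction.Hopf._^H_ K p n f (Construction.Hopf.z K p n f (p ^ s)) p i) (Field.0# K)
lemma5p3 K p p-prime ιp≈0 n _ f _ s s<r =
  z^H-vanishes K p n f p pˢ<pʳ (ι-∣ K ιp≈0 (p∣multinomial p (p ^ s)))
  where
  instance
    p≢0 : NonZero p
    p≢0 = prime⇒nonZero p-prime
    pˢ≢0 : NonZero (p ^ s)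
    pˢ≢0 = ℕₚ.m^n≢0 p s
  pˢ<pʳ : p ^ s < p ^ (n ∸ 1)
  pˢ<pʳ = ℕₚ.^-monoʳ-< p (nonTrivial⇒n>1 p {{prime⇒nonTrivial p-prime}}) s<r
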